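{- For all rays $a,b,c$ such that the ray $b$ lies between the rays $a$ and $c$: (a) $a,b$ are divergent, $b,c$ are divergent, and $a,c$ are divergent; (b) the ray $b$ lies between the rays $c$ and $a$; (c) the ray $a$ does not lie between $b$ and $c$, and the ray $c$ does not lie between $a$ and $b$.
   Context: Synthetic plane geometry with classical logic. Primitive notions: points, lines (with equality), incidence $A\in x$, a ternary betweenness relation $\mathrm{Bet}(A,B,C)$ ("$B$ strictly between $A$ and $C$"), lengths with a map $(A,B)\mapsto|AB|$. Points are collinear if some line contains all of them. Axioms: (incidence) there is a point; for every point there is a distinct point; every line has a point; for every line $x$ and $A\in x$ there is $B\in x$, $B\neq A$; for every line there is a point not on it; through two distinct points there is a line; if $A\neq B$, $A,B\in x$ and $x\neq y$ then $A\notin y$ or $B\notin y$. (betweenness) if $\mathrm{Bet}(A,B,C)$ then $A\neq C$, $A,B,C$ collinear, $\mathrm{Bet}(C,B,A)$, and not $\mathrm{Bet}(B,A,C)$. (lengths) $|AB|=|CC|$ iff $A=B$; $|AB|=|BA|$. (line–circle) for $O,A,B$ with $A\neq O$ there is $C$ with ($\mathrm{Bet}(A,O,C)$ or $O=C$) and $|OB|=|OC|$. "$P,Q$ on opposite sides of line $x$": $P,Q\notin x$ and some $O\in x$ has $\mathrm{Bet}(P,O,Q)$; "same side of $x$": $P,Q\notin x$ and no such $O$ exists. (Pasch) if $P,Q$ are on opposite sides of $x$ and $R\notin x$, then $P,R$ or $R,Q$ are on opposite sides of $x$. A ray is an ordered pair $a=(a_0,a_1)$ of distinct points; $\ell_a$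 denotes the line through $a_0,a_1$. Rays $a,b$ are divergent iff $a_0=b_0$ and $a_0,a_1,b_1$ are not collinear. Rays $b,c$ lie on the same side of ray $a$ iff $a_0=b_0=c_0$ and $b_1,c_1$ lie on the same side of $\ell_a$. The ray $b$ lies between the rays $a$ and $c$ iff $b,c$ lie on the same side of $a$ and $b,a$ lie on the same side of $c$. -}

module Defs where

open import Level using (Level; _⊔_; suc)
open import Data.Product using (Σ; _×_; _,_; ∃; ∃-syntax)
open import Data.Sum using (_⊎_)
open import Data.Empty using (⊥)
open import Relation.Nullary using (¬_)
open import Relation.Binary.PropositionalEquality using (_≡_; _≢_)

record Plane (ℓ : Level) : Set (suc ℓ) where
  field
    Point  : Set ℓ
    Line   : Set ℓ
    Length : Set ℓ
    _∈_    : Point → Line → Set ℓ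
    Bet    : Point → Point → Point → Set ℓ
    ∣_,_∣  : Point → Point → Length

  Collinear3 : Point → Point → Point → Set ℓ
  Collinear3 A B C = ∃[ x ] (A ∈ x × B ∈ x × C ∈ x)

  OppositeSides : Point → Point → Line → Set ℓ
  OppositeSides P Q x = ¬ (P ∈ x) × ¬ (Q ∈ x) × (∃[ O ] (O ∈ x × Bet P O Q))

  SameSide : Point → Point → Line → Set ℓ
  SameSide P Q x = ¬ (P ∈ x) × ¬ (Q ∈ x) × ¬ (∃[ O ] (O ∈ x × Bet P O Q))

  field
    lem : ∀ (P : Set ℓ) → P ⊎ ¬ P
    ax-point        : Point
    ax-other-point  : ∀ (A : Point) → ∃[ B ] (B ≢ A)
    ax-line-point   : ∀ (x : Line) → ∃[ A ] (A ∈ x)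
    ax-line-other   : ∀ (x : Line) (A : Point) → A ∈ x → ∃[ B ] (B ∈ x × B ≢ A)
    ax-off-line     : ∀ (x : Line) → ∃[ P ] ¬ (P ∈ x)
    ax-line-through : ∀ (A B : Point) → A ≢ B → ∃[ x ] (A ∈ x × B ∈ x)
    ax-line-unique  : ∀ {A B : Point} {x y : Line} → A ≢ B → A ∈ x → B ∈ x →
                      x ≢ y → ¬ (A ∈ y) ⊎ ¬ (B ∈ y)
    bet-distinct    : ∀ {A B C} → Bet A B C → A ≢ C
    bet-collinear   : ∀ {A B C} → Bet A B C → Collinear3 A B C
    bet-sym         : ∀ {A B C} → Bet A B C → Bet C B A
    bet-not         : ∀ {A B C} → Bet A B C → ¬ Bet B A C
    len-zero        : ∀ {A B C} → (∣ A , B ∣ ≡ ∣ C , C ∣ → A ≡ B) × (A ≡ B → ∣ A , B ∣ ≡ ∣ C , C ∣)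
    len-sym         : ∀ {A B} → ∣ A , B ∣ ≡ ∣ B , A ∣
    line-circle     : ∀ (O A B : Point) → A ≢ O →
                      ∃[ C ] ((Bet A O C ⊎ O ≡ C) × ∣ O , B ∣ ≡ ∣ O , C ∣)
    pasch           : ∀ {P Q R : Point} {x : Line} → OppositeSides P Q x → ¬ (R ∈ x) →
                      OppositeSides P R x ⊎ OppositeSides R Q x

  record Ray : Set ℓ where
    constructor ray
    field
      r₀ r₁    : Point
      distinct : r₀ ≢ r₁
  open Ray public

  -- x is the line ℓ_a through a₀ and a₁ (unique by ax-line-unique)
  IsLineOf : Ray → Line → Set ℓ
  IsLineOf a x = r₀ a ∈ x × r₁ a ∈ x

  Divergent : Ray → Ray → Set ℓ
  Divergent a b = r₀ a ≡ r₀ b × ¬ Collinear3 (r₀ a) (r₁ a) (r₁ b)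

  SameSideOfRay : Ray → Ray → Ray → Set ℓ
  SameSideOfRay b c a =
    r₀ a ≡ r₀ b × r₀ b ≡ r₀ c × (∀ x → IsLineOf a x → SameSide (r₁ b) (r₁ c) x)

  Between : Ray → Ray → Ray → Set ℓ
  Between a b c = SameSideOfRay b c a × SameSideOfRay b a c

module Submission where

-- Reflect a₁ through the common origin O to a′.  Since a₁ and c₁ lie on the same side of ℓ_b,
-- the segment a′c₁ crosses ℓ_b at some P; since a₁ and b₁ lie on the same side of ℓ_c, so do a′
-- and P, whence the segment Pb₁ crosses ℓ_c, and it can only do so at O.  But P lies on the
-- same side of ℓ_a as c₁, hence as b₁, and O ∈ ℓ_a: so no three rays from O can each have the
-- other two on one side.  Part (c) is exactly this, parts (a) and (b) are immediate.

open import Defs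
open import Level using (Level)
open import Data.Product using (_×_; _,_; proj₁; proj₂; ∃-syntax)
open import Data.Sum using (inj₁; inj₂; [_,_])
open import Data.Empty using (⊥; ⊥-elim)
open import Relation.Nullary using (¬_)
open import Relation.Binary.PropositionalEquality using (_≡_; _≢_; refl; sym; subst)

module Geometry {ℓ : Level} (𝒫 : Plane ℓ) where
  open Plane 𝒫

  bet-≢ˡ : ∀ {A B C} → Bet A B C → A ≢ B
  bet-≢ˡ h refl = bet-not h h

  bet-≢ʳ : ∀ {A B C} → Bet A B C → B ≢ C
  bet-≢ʳ h B≡C = bet-≢ˡ (bet-sym h) (sym B≡C)

  line-unique : ∀ {A B x y} → A ≢ B → A ∈ x → B ∈ x → A ∈ y → B ∈ y → x ≡ y
  line-unique {x = x} {y} A≢B Ax Bx Ay By with lem (x ≡ y)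
  ... | inj₁ x≡y = x≡y
  ... | inj₂ x≢y with ax-line-unique A≢B Ax Bx x≢y
  ... | inj₁ A∉y = ⊥-elim (A∉y Ay)
  ... | inj₂ B∉y = ⊥-elim (B∉y By)

  lines-meet-once : ∀ {A B x y} → A ≢ B → A ∈ x → B ∈ x → A ∈ y → B ∈ y →
                    ∀ {C} → C ∈ x → C ∈ y
  lines-meet-once A≢B Ax Bx Ay By Cx = subst (_ ∈_) (line-unique A≢B Ax Bx Ay By) Cx

  line-of : (a : Ray) → ∃[ x ] IsLineOf a x
  line-of (ray a₀ a₁ a₀≢a₁) = ax-line-through a₀ a₁ a₀≢a₁

  bet-extend : ∀ {A O} → A ≢ O → ∃[ C ] Bet A O C
  bet-extend {A} {O} A≢O with ax-other-point O
  ... | B , B≢O with line-circle O A B A≢O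
  ... | C , inj₁ AOC , _ = C , AOC
  ... | C , inj₂ refl , OB≡OO = ⊥-elim (B≢O (sym (proj₁ len-zero OB≡OO)))

  opposite-sym : ∀ {P Q x} → OppositeSides P Q x → OppositeSides Q P x
  opposite-sym (P∉x , Q∉x , O , Ox , POQ) = Q∉x , P∉x , O , Ox , bet-sym POQ

  sameSide-sym : ∀ {P Q x} → SameSide P Q x → SameSide Q P x
  sameSide-sym (P∉x , Q∉x , ¬cross) =
    Q∉x , P∉x , λ { (O , Ox , QOP) → ¬cross (O , Ox , bet-sym QOP) }

  sameSide-trans : ∀ {P Q R x} → SameSide P Q x → SameSide Q R x → SameSide P R x
  sameSide-trans (P∉x , Q∉x , ¬PQ) (_ , R∉x , ¬QR) = P∉x , R∉x , λ PR →
    [ (λ { (_ , _ , PQ) → ¬PQ PQ }) , (λ { (_ , _ , QR) → ¬QR QR }) ]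
      (pasch (P∉x , R∉x , PR) Q∉x)

  sameSide⇒¬bet : ∀ {P Q O x} → SameSide P Q x → O ∈ x → ¬ Bet P O Q
  sameSide⇒¬bet (_ , _ , ¬cross) Ox POQ = ¬cross (_ , Ox , POQ)

  opposite-sameSide : ∀ {P Q R x} → OppositeSides P Q x → SameSide Q R x → OppositeSides P R x
  opposite-sameSide PQ (_ , R∉x , ¬QR) with pasch PQ R∉x
  ... | inj₁ PR = PR
  ... | inj₂ (_ , _ , O , Ox , ROQ) = ⊥-elim (¬QR (O , Ox , bet-sym ROQ))

  bet-opposite : ∀ {A O B x} → Bet A O B → O ∈ x → ¬ A ∈ x → OppositeSides A B x
  bet-opposite AOB Ox A∉x with bet-collinear AOB
  ... | z , Az , Oz , Bz =
    A∉x , (λ Bx → A∉x (lines-meet-once (bet-≢ʳ AOB) Oz Bz Ox Bx Az)) , _ , Ox , AOB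

  bet-sameSide : ∀ {A P Q x} → Bet A P Q → Q ∈ x → ¬ A ∈ x → SameSide A P x
  bet-sameSide {A} {P} {Q} {x} APQ Qx A∉x with bet-collinear APQ
  ... | z , Az , Pz , Qz = A∉x , P∉x , λ { (O , Ox , AOP) → ¬cross O Ox AOP }
    where
      P∉x : ¬ P ∈ x
      P∉x Px = A∉x (lines-meet-once (bet-≢ʳ APQ) Pz Qz Px Qx Az)

      ¬cross : ∀ O → O ∈ x → ¬ Bet A O P
      ¬cross O Ox AOP with bet-collinear AOP
      ... | w , Aw , Ow , Pw with lem (O ≡ Q)
      ... | inj₁ refl = bet-not (bet-sym APQ) (bet-sym AOP)
      ... | inj₂ O≢Q =
        A∉x (lines-meet-once O≢Q (lines-meet-once (bet-distinct AOP) Aw Pw Az Pz Ow) Qz Ox Qx Az)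

  crossing-at-origin : ∀ {O P Q B x y} → Bet P Q B → Q ∈ x → O ∈ x → ¬ B ∈ x →
                       P ∈ y → B ∈ y → O ∈ y → Q ≡ O
  crossing-at-origin {O} {Q = Q} PQB Qx Ox B∉x Py By Oy with bet-collinear PQB
  ... | w , Pw , Qw , Bw with lem (Q ≡ O)
  ... | inj₁ Q≡O = Q≡O
  ... | inj₂ Q≢O =
    ⊥-elim (B∉x (lines-meet-once Q≢O (lines-meet-once (bet-distinct PQB) Pw Bw Py By Qw) Oy Qx Ox By))

  ¬pairwise-sameSide : ∀ {O a₁ b₁ c₁ ℓa ℓb ℓc} →
    O ∈ ℓa → a₁ ∈ ℓa → O ∈ ℓb → b₁ ∈ ℓb → O ∈ ℓc → c₁ ∈ ℓc → a₁ ≢ O →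
    SameSide b₁ c₁ ℓa → SameSide a₁ b₁ ℓc → SameSide a₁ c₁ ℓb → ⊥
  ¬pairwise-sameSide {O} {b₁ = b₁} {c₁} {ℓa} {ℓc = ℓc}
                     Oa a₁a Ob b₁b Oc c₁c a₁≢O bc∣a ab∣c ac∣b with bet-extend a₁≢O
  ... | a′ , a₁Oa′ with opposite-sameSide (opposite-sym (bet-opposite a₁Oa′ Ob (proj₁ ac∣b))) ac∣b
  ... | _ , _ , P , Pb , a′Pc₁ with opposite-sym (opposite-sameSide (opposite-sym a′b₁∣c) a′P∣c)
    where
      a′b₁∣c : OppositeSides a′ b₁ ℓc
      a′b₁∣c = opposite-sameSide (opposite-sym (bet-opposite a₁Oa′ Oc (proj₁ ab∣c))) ab∣c

      a′P∣c : SameSide a′ P ℓc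
      a′P∣c = bet-sameSide a′Pc₁ c₁c (proj₁ a′b₁∣c)
  ... | _ , _ , Q , Qc , PQb₁ =
    sameSide⇒¬bet (sameSide-trans (sameSide-sym c₁P∣a) (sameSide-sym bc∣a)) Oa
      (subst (λ X → Bet P X b₁) Q≡O PQb₁)
    where
      Q≡O : Q ≡ O
      Q≡O = crossing-at-origin PQb₁ Qc Oc (proj₁ (proj₂ ab∣c)) Pb b₁b Ob

      a′∈ℓa : a′ ∈ ℓa
      a′∈ℓa with bet-collinear a₁Oa′
      ... | z , a₁z , Oz , a′z = lines-meet-once a₁≢O a₁z Oz a₁a Oa a′z

      c₁P∣a : SameSide c₁ P ℓa
      c₁P∣a = bet-sameSide (bet-sym a′Pc₁) a′∈ℓa (proj₁ (proj₂ bc∣a))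

  sameSideOfRay-sym : ∀ {a b c} → SameSideOfRay b c a → SameSideOfRay c b a
  sameSideOfRay-sym (refl , refl , bc∣a) = refl , refl , λ x a∈x → sameSide-sym (bc∣a x a∈x)

  sameSideOfRay⇒divergent : ∀ {a b c} → SameSideOfRay b c a → Divergent a b × Divergent a c
  sameSideOfRay⇒divergent (refl , refl , bc∣a) =
    (refl , λ { (x , a₀x , a₁x , b₁x) → proj₁ (bc∣a x (a₀x , a₁x)) b₁x })
    , (refl , λ { (x , a₀x , a₁x , c₁x) → proj₁ (proj₂ (bc∣a x (a₀x , a₁x))) c₁x })

  divergent-sym : ∀ {a b} → Divergent a b → Divergent b a
  divergent-sym (refl , ¬col) = refl , λ { (x , b₀x , b₁x , a₁x) → ¬col (x , b₀x , a₁x , b₁x) }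

  ¬pairwise-sameSideOfRay : ∀ {a b c} →
    SameSideOfRay b c a → SameSideOfRay a b c → SameSideOfRay a c b → ⊥
  ¬pairwise-sameSideOfRay {ray O a₁ O≢a₁} {ray .O b₁ O≢b₁} {ray .O c₁ O≢c₁}
                          (refl , refl , bc∣a) (_ , _ , ab∣c) (_ , _ , ac∣b)
    with line-of (ray O a₁ O≢a₁) | line-of (ray O b₁ O≢b₁) | line-of (ray O c₁ O≢c₁)
  ... | ℓa , Oa , a₁a | ℓb , Ob , b₁b | ℓc , Oc , c₁c =
    ¬pairwise-sameSide Oa a₁a Ob b₁b Oc c₁c (λ a₁≡O → O≢a₁ (sym a₁≡O))
      (bc∣a ℓa (Oa , a₁a)) (ab∣c ℓc (Oc , c₁c)) (ac∣b ℓb (Ob , b₁b))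

theorem11 : ∀ {ℓ : Level} (𝒫 : Plane ℓ) → let open Plane 𝒫 in
            ∀ (a b c : Ray) → Between a b c →
            ((Divergent a b × Divergent b c × Divergent a c)
             × Between c b a
             × (¬ Between b a c × ¬ Between a c b))
theorem11 𝒫 a b c (bc∣a , ba∣c) =
  (ab , divergent-sym {c} {b} cb , ac)
  , (ba∣c , bc∣a)
  , (λ { (ac∣b , ab∣c) → ¬pairwise-sameSideOfRay {a} {b} {c} bc∣a ab∣c ac∣b })
  , (λ { (_ , ca∣b) → ¬pairwise-sameSideOfRay {a} {b} {c} bc∣a
                        (sameSideOfRay-sym {c} {b} {a} ba∣c) (sameSideOfRay-sym {b} {c} {a} ca∣b) })
  where
    open Geometry 𝒫
    open Plane 𝒫 using (Divergent)

    ab : Divergent a b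
    ab = proj₁ (sameSideOfRay⇒divergent {a} {b} {c} bc∣a)

    ac : Divergent a c
    ac = proj₂ (sameSideOfRay⇒divergent {a} {b} {c} bc∣a)

    cb : Divergent c b
    cb = proj₁ (sameSideOfRay⇒divergent {c} {b} {a} ba∣c)
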